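{- Let $a_0\in\mathcal{A}$, $t\in\mathcal{A}^\omega$, and suppose $z=\psi_{a_0}(t)$ is a standard episturmian sequence. Let $w=a_0ya_1$ be a factor of $z$, with $a_1\in\mathcal{A}$, $a_1\neq a_0$ and $y\in\mathcal{A}^*$. Then there exists a factor $u$ of $t$ such that $\psi_{a_0}(u)=w$.
   Context: For a letter $a$: $\psi_a(a)=a$ and $\psi_a(x)=ax$ for letters $x\neq a$, extended to a morphism on finite and infinite words. An infinite word $s$ is standard episturmian if for every prefix $u$ of $s$, the shortest palindrome having $u$ as a prefix is also a prefix of $s$. -}

module Defs where

open import Data.Nat using (ℕ; zero; suc; _+_; _≤_)
open import Data.List using (List; []; _∷_; _++_; length; reverse)
open import Data.Product using (∃; _×_)
open import Relation.Nullary using (yes; no)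
open import Relation.Binary.Definitions using (DecidableEquality)
open import Relation.Binary.PropositionalEquality using (_≡_)

takeω : {A : Set} → ℕ → (ℕ → A) → List A
takeω zero    s = []
takeω (suc n) s = s 0 ∷ takeω n (λ k → s (suc k))

dropω : {A : Set} → ℕ → (ℕ → A) → (ℕ → A)
dropω i s = λ k → s (i + k)

Factorω : {A : Set} → List A → (ℕ → A) → Set
Factorω w s = ∃ λ i → takeω (length w) (dropω i s) ≡ w

Prefix : {A : Set} → List A → List A → Set
Prefix u v = ∃ λ r → u ++ r ≡ v

Prefixω : {A : Set} → List A → (ℕ → A) → Set
Prefixω p s = takeω (length p) s ≡ p

Palindrome : {A : Set} → List A → Set
Palindrome p = reverse p ≡ p

ShortestPalWithPrefix : {A : Set} → List A → List A → Set
ShortestPalWithPrefix u p =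
  Palindrome p × Prefix u p ×
  (∀ q → Palindrome q → Prefix u q → length p ≤ length q)

StandardEpisturmian : {A : Set} → (ℕ → A) → Set
StandardEpisturmian s =
  ∀ n p → ShortestPalWithPrefix (takeω n s) p → Prefixω p s

ψ-letter : {A : Set} → DecidableEquality A → A → A → List A
ψ-letter _≟_ a x with x ≟ a
... | yes _ = a ∷ []
... | no  _ = a ∷ x ∷ []

ψ : {A : Set} → DecidableEquality A → A → List A → List A
ψ _≟_ a []       = []
ψ _≟_ a (x ∷ xs) = ψ-letter _≟_ a x ++ ψ _≟_ a xs

ψω : {A : Set} → DecidableEquality A → A → (ℕ → A) → (ℕ → A)
ψω _≟_ a t zero with t 0 ≟ a
... | yes _ = a
... | no  _ = a
ψω _≟_ a t (suc i) with t 0 ≟ a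
... | yes _ = ψω _≟_ a (λ k → t (suc k)) i
ψω _≟_ a t (suc zero)    | no _ = t 0
ψω _≟_ a t (suc (suc i)) | no _ = ψω _≟_ a (λ k → t (suc k)) i

module Submission where

-- Lemma 6.8 is a pure desubstitution property of ψ_a.  Write ψ_a(t) = ψ_a(t₀) ψ_a(t₁) ⋯, where every
-- block ψ_a(tₙ) is either a or a tₙ with tₙ ≠ a.
--   * Every block begins with a and the letter a occurs nowhere else, so a
--     suffix of ψ_a(t) that begins with a starts at a block boundary.  That
--     suffix is therefore ψ_a of a suffix of t (suffix-desubstitution).
--   * A block ends with a letter b ≠ a only if it is a complete block a b.  A
--     prefix of ψ_a(t) ending in b ≠ a therefore consists of whole blocks and
--     is ψ_a of a prefix of t (prefix-desubstitution).  The theorem applies the suffix lemma at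
-- the occurrence of w = a₀ y a₁ and then the prefix lemma to that suffix.

open import Defs
open import Data.Nat using (ℕ; zero; suc; _+_)
open import Data.List using (List; []; _∷_; _++_)
open import Data.List.Properties using (∷-injective; ∷-injectiveˡ)
open import Data.Product using (∃; _×_; _,_)
open import Data.Empty using (⊥-elim)
open import Relation.Nullary using (Dec; yes; no)
open import Relation.Binary.Definitions using (DecidableEquality)
open import Relation.Binary.PropositionalEquality
  using (_≡_; _≢_; refl; sym; trans; cong; cong₂)

takeω-cong : {A : Set} (n : ℕ) {s s′ : ℕ → A} →
             (∀ k → s k ≡ s′ k) → takeω n s ≡ takeω n s′
takeω-cong zero    eq = refl
takeω-cong (suc n) eq = cong₂ _∷_ (eq 0) (takeω-cong n (λ k → eq (suc k)))

module Desubstitution {A : Set} (_≟_ : DecidableEquality A) (a : A) where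

  tail : (ℕ → A) → (ℕ → A)
  tail t k = t (suc k)

  ψ-cons-a : ∀ {x} u → x ≡ a → ψ _≟_ a (x ∷ u) ≡ a ∷ ψ _≟_ a u
  ψ-cons-a {x} u x≡a with x ≟ a
  ... | yes _   = refl
  ... | no  x≢a = ⊥-elim (x≢a x≡a)

  ψ-cons-other : ∀ {x} u → x ≢ a → ψ _≟_ a (x ∷ u) ≡ a ∷ x ∷ ψ _≟_ a u
  ψ-cons-other {x} u x≢a with x ≟ a
  ... | yes x≡a = ⊥-elim (x≢a x≡a)
  ... | no  _   = refl

  ψω-head : ∀ t → ψω _≟_ a t 0 ≡ a
  ψω-head t with t 0 ≟ a
  ... | yes _ = refl
  ... | no  _ = refl

  ψω-shift-a : ∀ t → t 0 ≡ a → ∀ i → ψω _≟_ a t (suc i) ≡ ψω _≟_ a (tail t) i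
  ψω-shift-a t t₀≡a i with t 0 ≟ a
  ... | yes _   = refl
  ... | no  t₀≢a = ⊥-elim (t₀≢a t₀≡a)

  ψω-second : ∀ t → t 0 ≢ a → ψω _≟_ a t 1 ≡ t 0
  ψω-second t t₀≢a with t 0 ≟ a
  ... | yes t₀≡a = ⊥-elim (t₀≢a t₀≡a)
  ... | no  _    = refl

  ψω-shift-other : ∀ t → t 0 ≢ a → ∀ i →
                   ψω _≟_ a t (suc (suc i)) ≡ ψω _≟_ a (tail t) i
  ψω-shift-other t t₀≢a i with t 0 ≟ a
  ... | yes t₀≡a = ⊥-elim (t₀≢a t₀≡a)
  ... | no  _    = refl

  takeψω-a : ∀ t → t 0 ≡ a → ∀ n →
             takeω (suc n) (ψω _≟_ a t) ≡ a ∷ takeω n (ψω _≟_ a (tail t))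
  takeψω-a t t₀≡a n =
    cong₂ _∷_ (ψω-head t) (takeω-cong n (ψω-shift-a t t₀≡a))

  takeψω-other : ∀ t → t 0 ≢ a → ∀ n →
                 takeω (suc (suc n)) (ψω _≟_ a t) ≡ a ∷ t 0 ∷ takeω n (ψω _≟_ a (tail t))
  takeψω-other t t₀≢a n =
    cong₂ _∷_ (ψω-head t)
      (cong₂ _∷_ (ψω-second t t₀≢a) (takeω-cong n (ψω-shift-other t t₀≢a)))

  -- A suffix of ψ_a(t) beginning with a is ψ_a of a suffix of t: the letter
  -- a only occurs at block boundaries.  The case split is on the first block.
  suffix-desubstitution : ∀ i t → dropω i (ψω _≟_ a t) 0 ≡ a →
    ∃ λ j → ∀ k → dropω i (ψω _≟_ a t) k ≡ ψω _≟_ a (dropω j t) k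
  suffix-desubstitution i t = by-first-block i (t 0 ≟ a)
    where
    by-first-block : ∀ i → Dec (t 0 ≡ a) → dropω i (ψω _≟_ a t) 0 ≡ a →
      ∃ λ j → ∀ k → dropω i (ψω _≟_ a t) k ≡ ψω _≟_ a (dropω j t) k
    by-first-block zero _ _ = 0 , λ _ → refl
    by-first-block (suc i) (yes t₀≡a) starts-a
      with suffix-desubstitution i (tail t)
             (trans (sym (ψω-shift-a t t₀≡a (i + 0))) starts-a)
    ... | j , same = suc j , λ k → trans (ψω-shift-a t t₀≡a (i + k)) (same k)
    by-first-block (suc zero) (no t₀≢a) starts-a =
      ⊥-elim (t₀≢a (trans (sym (ψω-second t t₀≢a)) starts-a))
    by-first-block (suc (suc i)) (no t₀≢a) starts-a
      with suffix-desubstitution i (tail t)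
             (trans (sym (ψω-shift-other t t₀≢a (i + 0))) starts-a)
    ... | j , same = suc j , λ k → trans (ψω-shift-other t t₀≢a (i + k)) (same k)

  -- A prefix of ψ_a(t) ending in a letter b ≠ a consists of whole blocks, so
  -- it is ψ_a of a prefix of t.
  prefix-desubstitution : ∀ t v b → b ≢ a →
    Prefixω (v ++ b ∷ []) (ψω _≟_ a t) →
    ∃ λ u → Prefixω u t × ψ _≟_ a u ≡ v ++ b ∷ []
  prefix-desubstitution t v b b≢a = by-first-block v (t 0 ≟ a)
    where
    by-first-block : ∀ v → Dec (t 0 ≡ a) → Prefixω (v ++ b ∷ []) (ψω _≟_ a t) →
      ∃ λ u → Prefixω u t × ψ _≟_ a u ≡ v ++ b ∷ []
    by-first-block [] _ prefix =
      ⊥-elim (b≢a (trans (sym (∷-injectiveˡ prefix)) (ψω-head t)))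
    by-first-block (x ∷ v) (yes t₀≡a) prefix
      with ∷-injective (trans (sym (takeψω-a t t₀≡a _)) prefix)
    ... | a≡x , rest with prefix-desubstitution (tail t) v b b≢a rest
    ...   | u , u-prefix , ψu = t 0 ∷ u , cong (t 0 ∷_) u-prefix ,
            trans (ψ-cons-a u t₀≡a) (cong₂ _∷_ a≡x ψu)
    by-first-block (x ∷ []) (no t₀≢a) prefix =
      t 0 ∷ [] , refl ,
      trans (ψ-cons-other [] t₀≢a) (trans (sym (takeψω-other t t₀≢a 0)) prefix)
    by-first-block (x ∷ x′ ∷ v) (no t₀≢a) prefix
      with ∷-injective (trans (sym (takeψω-other t t₀≢a _)) prefix)
    ... | a≡x , blocks with ∷-injective blocks
    ...   | t₀≡x′ , rest with prefix-desubstitution (tail t) v b b≢a rest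
    ...     | u , u-prefix , ψu = t 0 ∷ u , cong (t 0 ∷_) u-prefix ,
              trans (ψ-cons-other u t₀≢a) (cong₂ _∷_ a≡x (cong₂ _∷_ t₀≡x′ ψu))

  factor-desubstitution : ∀ t y b → b ≢ a →
    Factorω (a ∷ y ++ b ∷ []) (ψω _≟_ a t) →
    ∃ λ u → Factorω u t × ψ _≟_ a u ≡ a ∷ y ++ b ∷ []
  factor-desubstitution t y b b≢a (i , occurrence)
    with suffix-desubstitution i t (∷-injectiveˡ occurrence)
  ... | j , same with prefix-desubstitution (dropω j t) (a ∷ y) b b≢a
                       (trans (sym (takeω-cong _ same)) occurrence)
  ...   | u , u-prefix , ψu = u , (j , u-prefix) , ψu

lemma6p8 : {A : Set} (_≟_ : DecidableEquality A) (a₀ : A) (t : ℕ → A) →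
    StandardEpisturmian (ψω _≟_ a₀ t) →
    (y : List A) (a₁ : A) → a₁ ≢ a₀ →
    Factorω (a₀ ∷ y ++ a₁ ∷ []) (ψω _≟_ a₀ t) →
    ∃ λ u → Factorω u t × ψ _≟_ a₀ u ≡ a₀ ∷ y ++ a₁ ∷ []
lemma6p8 _≟_ a₀ t _ = Desubstitution.factor-desubstitution _≟_ a₀ t
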